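{- Let $\mathcal{M}=\langle X,\mathcal{T},i\rangle$ be a topological model. Define $x\sim y$ iff (a) for all $U\in\mathcal{T}$, $x\in U\Leftrightarrow y\in U$, and (b) for all atomic $A$, $x\in i(A)\Leftrightarrow y\in i(A)$. Let $x^*$ be the $\sim$-class of $x$, $X^*=\{x^*:x\in X\}$, $U^*=\{x^*: x\in U\}$ for $U\in\mathcal{T}$, $\mathcal{T}^*=\{U^*:U\in\mathcal{T}\}$, $i^*(A)=\{x^*:x\in i(A)\}$, and $\mathcal{M}^*=\langle X^*,\mathcal{T}^*,i^*\rangle$. Then for all $U\in\mathcal{T}$, $x\in U$ and all formulas $\phi$: $x,U\models_{\mathcal{M}}\phi$ iff $x^*,U^*\models_{\mathcal{M}^*}\phi$.
   Context: Formulas are built from a countable set $\mathsf{A}$ of atomic formulas (containing $\top,\bot$) by $\land,\neg,\Box,\mathsf{K}$. A topological model $\langle X,\mathcal{T},i\rangle$ has $\mathcal{T}$ a topology on $X$ and $i:\mathsf{A}\to\mathcal{P}(X)$ with $i(\top)=X$, $i(\bot)=\emptyset$. Satisfaction in a model $\langle Y,\mathcal{O},j\rangle$ is defined on pairs $(y,U)$ with $U\in\mathcal{O}$, $y\in U$: $y,U\models A$ iff $y\in j(A)$; Boolean connectives as usual; $y,U\models\mathsf{K}\phi$ iff $z,U\models\phi$ for all $z\in U$; $y,U\models\Box\phi$ iff $y,V\models\phi$ for all $V\in\mathcal{O}$ with $V\subseteq U$ and $y\in V$. -}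

module Defs where

open import Level using (Level; _⊔_; Lift) renaming (suc to lsuc; zero to lzero)
open import Data.Nat using (ℕ)
open import Data.Product using (Σ; ∃; _×_; _,_; proj₁)
open import Data.Unit using (⊤)
open import Data.Empty using (⊥)
open import Relation.Nullary using (¬_)
open import Function.Bundles using (_⇔_; mk⇔)

data Atom : Set where
  atop : Atom
  abot : Atom
  var  : ℕ → Atom

data Formula : Set where
  atom : Atom → Formula
  _∧_  : Formula → Formula → Formula
  ~_   : Formula → Formula
  □_   : Formula → Formula
  K_   : Formula → Formula

record Structure (a ℓ o : Level) : Set (lsuc (a ⊔ ℓ ⊔ o)) where
  field
    Carrier : Set a
    Open    : (Carrier → Set ℓ) → Set o
    val     : Atom → Carrier → Set ℓ

module _ {a ℓ o : Level} (S : Structure a ℓ o) where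
  open Structure S
  Sat : Carrier → (Carrier → Set ℓ) → Formula → Set (a ⊔ lsuc ℓ ⊔ o)
  Sat y U (atom A) = Lift (a ⊔ lsuc ℓ ⊔ o) (val A y)
  Sat y U (φ ∧ ψ)  = Sat y U φ × Sat y U ψ
  Sat y U (~ φ)    = ¬ Sat y U φ
  Sat y U (K φ)    = (z : Carrier) → U z → Sat z U φ
  Sat y U (□ φ)    = (V : Carrier → Set ℓ) → Open V → ((z : Carrier) → V z → U z) → V y → Sat y V φ

record TopModel : Set₁ where
  field
    Carrier    : Set
    Open       : (Carrier → Set) → Set
    val        : Atom → Carrier → Set
    open-univ  : Open (λ _ → ⊤)
    open-empty : Open (λ _ → ⊥)
    open-∩     : (U V : Carrier → Set) → Open U → Open V → Open (λ x → U x × V x)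
    open-⋃     : (I : Set) (f : I → Carrier → Set) → ((k : I) → Open (f k)) →
                 Open (λ x → Σ I (λ k → f k x))
    open-ext   : (U V : Carrier → Set) → ((x : Carrier) → U x ⇔ V x) → Open U → Open V
    val-top    : (x : Carrier) → val atop x
    val-bot    : (x : Carrier) → ¬ val abot x

  structure : Structure lzero lzero lzero
  structure = record { Carrier = Carrier ; Open = Open ; val = val }

  _∼_ : Carrier → Carrier → Set₁
  x ∼ y = ((U : Carrier → Set) → Open U → (U x ⇔ U y))
        × ((A : Atom) → (val A x ⇔ val A y))

  -- Equivalence classes of ∼ (as predicates on X); X* is the set of classes.
  X* : Set₂
  X* = Σ (Carrier → Set₁) (λ C → ∃ λ x → (y : Carrier) → C y ⇔ (x ∼ y))

  _is-class-of_ : X* → Carrier → Set₁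
  c is-class-of x = (y : Carrier) → proj₁ c y ⇔ (x ∼ y)

  ∼-refl : (x : Carrier) → x ∼ x
  ∼-refl x = (λ U _ → mk⇔ (λ p → p) (λ p → p)) , (λ A → mk⇔ (λ p → p) (λ p → p))

  _* : Carrier → X*
  x * = (λ y → x ∼ y) , x , (λ y → mk⇔ (λ p → p) (λ p → p))

  _*ˢ : (Carrier → Set) → X* → Set₁
  (U *ˢ) c = ∃ λ x → U x × (c is-class-of x)

  -- 𝒯* = { U* : U ∈ 𝒯 }  (V is in 𝒯* iff V equals some U* extensionally)
  Open* : (X* → Set₁) → Set₂
  Open* V = ∃ λ U → Open U × ((c : X*) → V c ⇔ (U *ˢ) c)

  val* : Atom → X* → Set₁
  val* A c = ∃ λ x → val A x × (c is-class-of x)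

  star : Structure (lsuc (lsuc lzero)) (lsuc lzero) (lsuc (lsuc lzero))
  star = record { Carrier = X* ; Open = Open* ; val = val* }

{-# OPTIONS --safe #-}
module Submission where

-- Opens and atomic valuations are unions of ∼-classes, so x ∈ U iff x* ∈ U*, and U ↦ U*
-- preserves and reflects inclusion between opens.  The satisfaction clauses only ever ask
-- about membership and inclusion, so truth transfers along x ↦ x*, U ↦ U* by induction on φ.
-- The induction is run for every class c of x and every V extensionally equal to U*,
-- because the opens of 𝒯* that the □ clause ranges over are only such V.

open import Defs
open import Data.Product using (_,_; proj₁; proj₂)
open import Data.Product.Function.NonDependent.Propositional using (_×-⇔_)
open import Function.Bundles using (_⇔_; mk⇔; Equivalence)
open import Function.Construct.Composition using (_⇔-∘_)
open import Function.Construct.Identity using (⇔-id)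
open import Function.Related.TypeIsomorphisms using (¬-cong-⇔)
open import Level using (lift; lower)
open import Relation.Unary using (_⊆′_)

open Equivalence

module _ (M : TopModel) where
  open TopModel M

  _represents_ : (X* → Set₁) → (Carrier → Set) → Set₂
  V represents U = (d : X*) → V d ⇔ (U *ˢ) d

  *ˢ-represents : (U : Carrier → Set) → (U *ˢ) represents U
  *ˢ-represents U d = ⇔-id _

  *-is-class-of : (x : Carrier) → (x *) is-class-of x
  *-is-class-of x y = ⇔-id _

  is-class-of⇒∼ : ∀ {c x y} → c is-class-of x → c is-class-of y → x ∼ y
  is-class-of⇒∼ {y = y} c∋x c∋y = to (c∋x y) (from (c∋y y) (∼-refl y))

  ∈val*⇔∈val : ∀ c {x} A → c is-class-of x → val* A c ⇔ val A x
  ∈val*⇔∈val c A c∋x =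
    mk⇔ (λ { (y , Ay , c∋y) → from (proj₂ (is-class-of⇒∼ {c} c∋x c∋y) A) Ay })
        (λ Ax → _ , Ax , c∋x)

  represented-∈⇔∈ : ∀ {U V c x} → Open U → V represents U → c is-class-of x → V c ⇔ U x
  represented-∈⇔∈ {U} {c = c} oU V≃U* c∋x =
    mk⇔ (λ { (y , Uy , c∋y) → from (proj₁ (is-class-of⇒∼ {c} c∋x c∋y) U oU) Uy })
        (λ Ux → _ , Ux , c∋x)
    ⇔-∘ V≃U* c

  represented-⊆-reflects : ∀ {U W V V′} → Open U → V represents U → V′ represents W →
                           V′ ⊆′ V → W ⊆′ U
  represented-⊆-reflects oU V≃U* V′≃W* V′⊆V w Ww =
    to (represented-∈⇔∈ oU V≃U* (*-is-class-of w))
       (V′⊆V (w *) (from (V′≃W* (w *)) (w , Ww , *-is-class-of w)))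

  ⊆⇒*ˢ⊆-represented : ∀ {U W V} → V represents U → W ⊆′ U → (W *ˢ) ⊆′ V
  ⊆⇒*ˢ⊆-represented V≃U* W⊆U d (w , Ww , d∋w) = from (V≃U* d) (w , W⊆U w Ww , d∋w)

  Sat-invariant : ∀ {U V c x} → Open U → V represents U → c is-class-of x → (φ : Formula) →
                  Sat structure x U φ ⇔ Sat star c V φ
  Sat-invariant {c = c} oU V≃U* c∋x (atom A) =
    mk⇔ (λ Ax → lift (from (∈val*⇔∈val c A c∋x) (lower Ax)))
        (λ Ac → lift (to (∈val*⇔∈val c A c∋x) (lower Ac)))
  Sat-invariant oU V≃U* c∋x (φ ∧ ψ) =
    Sat-invariant oU V≃U* c∋x φ ×-⇔ Sat-invariant oU V≃U* c∋x ψ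
  Sat-invariant oU V≃U* c∋x (~ φ) = ¬-cong-⇔ (Sat-invariant oU V≃U* c∋x φ)
  Sat-invariant {U} {V} {c} {x} oU V≃U* c∋x (K φ) = mk⇔ forth back
    where
    forth : Sat structure x U (K φ) → Sat star c V (K φ)
    forth Kφ d Vd with to (V≃U* d) Vd
    ... | y , Uy , d∋y = to (Sat-invariant oU V≃U* d∋y φ) (Kφ y Uy)

    back : Sat star c V (K φ) → Sat structure x U (K φ)
    back Kφ z Uz = from (Sat-invariant oU V≃U* (*-is-class-of z) φ)
                        (Kφ (z *) (from (represented-∈⇔∈ oU V≃U* (*-is-class-of z)) Uz))
  Sat-invariant {U} {V} {c} {x} oU V≃U* c∋x (□ φ) = mk⇔ forth back
    where
    forth : Sat structure x U (□ φ) → Sat star c V (□ φ)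
    forth □φ V′ (W , oW , V′≃W*) V′⊆V V′c =
      to (Sat-invariant oW V′≃W* c∋x φ)
         (□φ W oW (represented-⊆-reflects oU V≃U* V′≃W* V′⊆V)
                  (to (represented-∈⇔∈ oW V′≃W* c∋x) V′c))

    back : Sat star c V (□ φ) → Sat structure x U (□ φ)
    back □φ W oW W⊆U Wx =
      from (Sat-invariant oW (*ˢ-represents W) c∋x φ)
           (□φ (W *ˢ) (W , oW , *ˢ-represents W) (⊆⇒*ˢ⊆-represented V≃U* W⊆U) (x , Wx , c∋x))

mainTheorem5 : (M : TopModel) → (U : TopModel.Carrier M → Set) → TopModel.Open M U →
    (x : TopModel.Carrier M) → U x → (φ : Formula) →
    Sat (TopModel.structure M) x U φ ⇔ Sat (TopModel.star M) (TopModel._* M x) (TopModel._*ˢ M U) φ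
mainTheorem5 M U oU x _ = Sat-invariant M oU (*ˢ-represents M U) (*-is-class-of M x)
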